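{- Let $j\ge 0$ and $r\ge 1$ be integers. Then $$F_{j+1}^{(r)}=\sum_{\substack{k=0\\ r+k\equiv 0 \pmod 2}}^{r-1}\binom{r+k-1}{k}\binom{r-k+j-1}{j}\frac{L_{r-k+j}}{5^{(k+r)/2}}+\sum_{\substack{k=0\\ r+k\equiv 1 \pmod 2}}^{r-1}\binom{r+k-1}{k}\binom{r-k+j-1}{j}\frac{F_{r-k+j}}{5^{(k+r-1)/2}}.$$ In particular, $5F_{j+1}^{(2)}=(j+1)L_{j+2}+2F_{j+1}$ and $50F_{j+1}^{(3)}=5(j+1)(j+2)F_{j+3}+6(j+1)L_{j+2}+12F_{j+1}$.
   Context: $F_n$ denotes the $n$-th Fibonacci number ($F_0=0,F_1=1,F_{n+2}=F_{n+1}+F_n$) and $L_n$ the $n$-th Lucas number ($L_0=2,L_1=1,L_{n+2}=L_{n+1}+L_n$). For a positive integer $r$, the convolved Fibonacci numbers $F_{j+1}^{(r)}$ ($j\ge0$) are defined by $(1-z-z^2)^{ -r}=\sum_{j\ge 0}F_{j+1}^{(r)}z^j$. -}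

module Defs where

open import Data.Nat using (ℕ; zero; suc; _+_; _*_; _∸_; _^_; _%_; _≡ᵇ_)
open import Data.Nat.Properties using (m^n≢0)
open import Data.Nat.Combinatorics using (_C_)
open import Data.Bool using (if_then_else_)
open import Data.Integer using (+_)
open import Data.Rational as ℚ using (ℚ; _/_)

fib : ℕ → ℕ
fib zero = 0
fib (suc zero) = 1
fib (suc (suc n)) = fib (suc n) + fib n

lucas : ℕ → ℕ
lucas zero = 2
lucas (suc zero) = 1
lucas (suc (suc n)) = lucas (suc n) + lucas n

Σℕ< : ℕ → (ℕ → ℕ) → ℕ
Σℕ< zero f = 0
Σℕ< (suc n) f = Σℕ< n f + f n

Σℚ< : ℕ → (ℕ → ℚ) → ℚ
Σℚ< zero f = ℚ.0ℚ
Σℚ< (suc n) f = Σℚ< n f ℚ.+ f n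

-- Power-series coefficients of (1 - z - z^2)^(-r):
-- since 1/(1 - z - z^2) = Σ_j F_{j+1} z^j, the series (1 - z - z^2)^(-r)
-- is the r-fold Cauchy product of this series with itself.
-- convFib r j  is the coefficient of z^j, i.e.  F_{j+1}^{(r)}.
convFib : ℕ → ℕ → ℕ
convFib zero zero = 1
convFib zero (suc j) = 0
convFib (suc r) j = Σℕ< (suc j) (λ i → fib (suc i) * convFib r (j ∸ i))

_/5^_ : ℕ → ℕ → ℚ
a /5^ e = (+ a) / (5 ^ e)
  where instance _ = m^n≢0 5 e

rhs : ℕ → ℕ → ℚ
rhs r j =
  Σℚ< r (λ k → if (r + k) % 2 ≡ᵇ 0
                 then ((((r + k ∸ 1) C k) * ((r ∸ k + j ∸ 1) C j) * lucas (r ∸ k + j))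
                        /5^ ((k + r) Data.Nat./ 2))
                 else ℚ.0ℚ)
  ℚ.+
  Σℚ< r (λ k → if (r + k) % 2 ≡ᵇ 1
                 then ((((r + k ∸ 1) C k) * ((r ∸ k + j ∸ 1) C j) * fib (r ∸ k + j))
                        /5^ ((k + r ∸ 1) Data.Nat./ 2))
                 else ℚ.0ℚ)

-- Writing G_r(z) = (1 - z - z²)^(-r) = Σ_j convFib r j z^j, differentiation gives
-- (1 + 2z) G_r' + 4r G_r = 5r G_(r+1), because (1 - z - z²)' = -(1 + 2z) and
-- (1 + 2z)² + 4(1 - z - z²) = 5.  On coefficients this determines 5^(r-1) G_r from G_1
-- by a recursion in r.  The right-hand side, cleared of its powers of 5, is a sum over
-- m + d = r - 1 of C(m+2d, d) C(m+j, j) Y_m(m+j+1), where Y_m = fibLucas m, i.e.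
-- Y_(2h) = 5^h F and Y_(2h+1) = 5^h L; it satisfies the same recursion because of the absorption identities
-- for binomial coefficients and F_(t+1) + 2F_t = L_(t+1), L_(t+1) + 2L_t = 5F_(t+1).
module Submission where

open import Defs
open import Data.Bool using (if_then_else_)
open import Data.Integer as ℤ using (+_)
import Data.Integer.Properties as ℤP
open import Data.Nat as ℕ using (ℕ; zero; suc; pred; _+_; _*_; _∸_; _^_; _%_; _≡ᵇ_; _<_; _≥_; NonZero; z≤n; s≤s)
open import Data.Nat.Properties
open import Data.Nat.DivMod using ([m+kn]%n≡m%n; m*n/n≡m)
open import Data.Nat.Combinatorics
  using (_C_; nCn≡1; nC1≡n; nCk≡nC[n∸k]; nCk+nC[k+1]≡[n+1]C[k+1]; k>n⇒nCk≡0)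
open import Data.Nat.Tactic.RingSolver using (solve-∀)
import Data.Integer.Tactic.RingSolver as ℤ-Solver
open import Data.Product using (Σ; _×_; _,_; proj₁)
open import Data.Sum using (_⊎_; inj₁; inj₂)
open import Data.Rational as ℚ using (ℚ; _/_)
import Data.Rational.Properties as ℚP
open import Data.Rational.Unnormalised as ℚᵘ using (mkℚᵘ; *≡*)
import Data.Rational.Unnormalised.Properties as ℚᵘP
open import Relation.Binary.PropositionalEquality
open import Algebra.Bundles using (CommutativeMonoid)
import Algebra.Properties.CommutativeSemigroup as CommSemigroupProperties
module ℕ+ = CommSemigroupProperties +-commutativeSemigroup
module ℕ* = CommSemigroupProperties *-commutativeSemigroup
module ℚ+ = CommSemigroupProperties (CommutativeMonoid.commutativeSemigroup ℚP.+-0-commutativeMonoid)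

*≡*⇒/≡ : ∀ a b m n .{{_ : NonZero m}} .{{_ : NonZero n}} →
         a * n ≡ b * m → + a / m ≡ + b / n
*≡*⇒/≡ a b (suc m) (suc n) eq =
  ℚP.fromℚᵘ-cong {mkℚᵘ (+ a) m} {mkℚᵘ (+ b) n}
    (*≡* (trans (sym (ℤP.pos-* a (suc n))) (trans (cong +_ eq) (ℤP.pos-* b (suc m)))))

+-distrib-/ : ∀ a b n .{{_ : NonZero n}} → + (a + b) / n ≡ + a / n ℚ.+ + b / n
+-distrib-/ a b n@(suc n-1) = ℚP.toℚᵘ-injective (≃-sym (begin
  ℚ.toℚᵘ (+ a / n ℚ.+ + b / n)
    ≈⟨ ℚP.toℚᵘ-homo-+ (+ a / n) (+ b / n) ⟩
  ℚ.toℚᵘ (+ a / n) ℚᵘ.+ ℚ.toℚᵘ (+ b / n)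
    ≈⟨ ℚᵘP.+-cong (ℚP.toℚᵘ-fromℚᵘ (mkℚᵘ (+ a) n-1)) (ℚP.toℚᵘ-fromℚᵘ (mkℚᵘ (+ b) n-1)) ⟩
  mkℚᵘ (+ a) n-1 ℚᵘ.+ mkℚᵘ (+ b) n-1
    ≈⟨ *≡* cross ⟩
  mkℚᵘ (+ (a + b)) n-1
    ≈⟨ ℚP.toℚᵘ-fromℚᵘ (mkℚᵘ (+ (a + b)) n-1) ⟨
  ℚ.toℚᵘ (+ (a + b) / n) ∎))
  where
  open ℚᵘP.≃-Reasoning
  open ℚᵘP using (≃-sym)
  distrib : ∀ x y z → (x ℤ.* z ℤ.+ y ℤ.* z) ℤ.* z ≡ (x ℤ.+ y) ℤ.* (z ℤ.* z)
  distrib = ℤ-Solver.solve-∀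
  cross : (+ a ℤ.* + n ℤ.+ + b ℤ.* + n) ℤ.* + n ≡ + (a + b) ℤ.* + (n * n)
  cross = trans (distrib (+ a) (+ b) (+ n))
                (sym (cong₂ ℤ._*_ (ℤP.pos-+ a b) (ℤP.pos-* n n)))

nC0≡1 : ∀ n → n C 0 ≡ 1
nC0≡1 n = trans (nCk≡nC[n∸k] {0} {n} z≤n) (nCn≡1 n)

[k+1]*[n+1]C[k+1]≡[n+1]*nCk : ∀ n k → suc k * (suc n C suc k) ≡ suc n * (n C k)
[k+1]*[n+1]C[k+1]≡[n+1]*nCk zero zero = refl
[k+1]*[n+1]C[k+1]≡[n+1]*nCk zero (suc k)
  rewrite k>n⇒nCk≡0 {1} {suc (suc k)} (s≤s (s≤s z≤n)) | k>n⇒nCk≡0 {0} {suc k} (s≤s z≤n)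
  = *-zeroʳ (suc (suc k))
[k+1]*[n+1]C[k+1]≡[n+1]*nCk (suc n) zero
  rewrite nC1≡n (suc (suc n)) | nC0≡1 (suc n) = *-comm 1 (suc (suc n))
[k+1]*[n+1]C[k+1]≡[n+1]*nCk (suc n) (suc k) = begin
  suc (suc k) * (suc (suc n) C suc (suc k))
    ≡⟨ cong (suc (suc k) *_) (nCk+nC[k+1]≡[n+1]C[k+1] (suc n) (suc k)) ⟨
  suc (suc k) * (x + y)
    ≡⟨ *-distribˡ-+ (suc (suc k)) x y ⟩
  (x + suc k * x) + suc (suc k) * y
    ≡⟨ cong₂ (λ u v → (x + u) + v) ([k+1]*[n+1]C[k+1]≡[n+1]*nCk n k) ([k+1]*[n+1]C[k+1]≡[n+1]*nCk n (suc k)) ⟩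
  (x + suc n * (n C k)) + suc n * (n C suc k)
    ≡⟨ +-assoc x _ _ ⟩
  x + (suc n * (n C k) + suc n * (n C suc k))
    ≡⟨ cong (λ z → x + z) (*-distribˡ-+ (suc n) (n C k) (n C suc k)) ⟨
  x + suc n * (n C k + n C suc k)
    ≡⟨ cong (λ z → x + suc n * z) (nCk+nC[k+1]≡[n+1]C[k+1] n k) ⟩
  x + suc n * x ∎
  where
  open ≡-Reasoning
  x y : ℕ
  x = suc n C suc k
  y = suc n C suc (suc k)

[a+1]*[a+1+k]Ck≡[a+1+k]*[a+k]Ck : ∀ a k → suc a * ((suc a + k) C k) ≡ (suc a + k) * ((a + k) C k)
[a+1]*[a+1+k]Ck≡[a+1+k]*[a+k]Ck a k = begin
  suc a * ((suc a + k) C k)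
    ≡⟨ cong (suc a *_) (symmetric (suc a) k) ⟩
  suc a * ((suc a + k) C suc a)
    ≡⟨ [k+1]*[n+1]C[k+1]≡[n+1]*nCk (a + k) a ⟩
  (suc a + k) * ((a + k) C a)
    ≡⟨ cong ((suc a + k) *_) (symmetric a k) ⟨
  (suc a + k) * ((a + k) C k) ∎
  where
  open ≡-Reasoning
  symmetric : ∀ a k → (a + k) C k ≡ (a + k) C a
  symmetric a k = trans (nCk≡nC[n∸k] (m≤n+m k a)) (cong ((a + k) C_) (m+n∸n≡m a k))

Σℕ<-cong : ∀ n f g → (∀ i → i < n → f i ≡ g i) → Σℕ< n f ≡ Σℕ< n g
Σℕ<-cong zero f g f≗g = refl
Σℕ<-cong (suc n) f g f≗g =
  cong₂ _+_ (Σℕ<-cong n f g (λ i i<n → f≗g i (m<n⇒m<1+n i<n))) (f≗g n (n<1+n n))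

Σℕ<-suc : ∀ n f → Σℕ< (suc n) f ≡ f 0 + Σℕ< n (λ i → f (suc i))
Σℕ<-suc zero f = +-comm 0 (f 0)
Σℕ<-suc (suc n) f = trans (cong (_+ f (suc n)) (Σℕ<-suc n f)) (+-assoc (f 0) _ _)

Σℕ<-distrib-+ : ∀ n f g → Σℕ< n (λ i → f i + g i) ≡ Σℕ< n f + Σℕ< n g
Σℕ<-distrib-+ zero f g = refl
Σℕ<-distrib-+ (suc n) f g =
  trans (cong (_+ (f n + g n)) (Σℕ<-distrib-+ n f g)) (ℕ+.interchange (Σℕ< n f) (Σℕ< n g) (f n) (g n))

Σℚ<+Σℚ<≡Σℕ</ : ∀ n (A B : ℕ → ℚ) (c : ℕ → ℕ) D .{{_ : NonZero D}} →
              (∀ k → k < n → A k ℚ.+ B k ≡ + c k / D) →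
              Σℚ< n A ℚ.+ Σℚ< n B ≡ + Σℕ< n c / D
Σℚ<+Σℚ<≡Σℕ</ zero A B c D _ = trans (ℚP.+-identityˡ ℚ.0ℚ) (sym (ℚP.0/n≡0 D))
Σℚ<+Σℚ<≡Σℕ</ (suc n) A B c D A+B≡c = begin
  (Σℚ< n A ℚ.+ A n) ℚ.+ (Σℚ< n B ℚ.+ B n)
    ≡⟨ ℚ+.interchange (Σℚ< n A) (A n) (Σℚ< n B) (B n) ⟩
  (Σℚ< n A ℚ.+ Σℚ< n B) ℚ.+ (A n ℚ.+ B n)
    ≡⟨ cong₂ ℚ._+_ (Σℚ<+Σℚ<≡Σℕ</ n A B c D (λ k k<n → A+B≡c k (m<n⇒m<1+n k<n))) (A+B≡c n (n<1+n n)) ⟩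
  + Σℕ< n c / D ℚ.+ + c n / D
    ≡⟨ +-distrib-/ (Σℕ< n c) (c n) D ⟨
  + Σℕ< (suc n) c / D ∎
  where open ≡-Reasoning

-- Convolved Fibonacci numbers

convFib[1,j]≡fib[1+j] : ∀ j → convFib 1 j ≡ fib (suc j)
convFib[1,j]≡fib[1+j] j = convolve-unit j (λ i → fib (suc i))
  where
  open ≡-Reasoning
  convolve-unit : ∀ j h → Σℕ< (suc j) (λ i → h i * convFib 0 (j ∸ i)) ≡ h j
  convolve-unit zero h = *-identityʳ (h 0)
  convolve-unit (suc j) h = begin
    Σℕ< (suc (suc j)) (λ i → h i * convFib 0 (suc j ∸ i))
      ≡⟨ Σℕ<-suc (suc j) _ ⟩
    h 0 * 0 + Σℕ< (suc j) (λ i → h (suc i) * convFib 0 (j ∸ i))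
      ≡⟨ cong₂ _+_ (*-zeroʳ (h 0)) (convolve-unit j (λ i → h (suc i))) ⟩
    h (suc j) ∎

-- (1 - z - z²) G_(s+1) = G_s on coefficients.
convFib-suc-recurrence : ∀ s j →
  convFib (suc s) (suc (suc j)) ≡ convFib (suc s) (suc j) + convFib (suc s) j + convFib s (suc (suc j))
convFib-suc-recurrence s j = begin
  convFib (suc s) (suc (suc j))
    ≡⟨ Σℕ<-suc (suc (suc j)) _ ⟩
  1 * g (suc (suc j)) + Σℕ< (suc (suc j)) (λ i → fib (suc (suc i)) * g (suc j ∸ i))
    ≡⟨ cong (λ z → 1 * g (suc (suc j)) + z) (Σℕ<-suc (suc j) _) ⟩
  1 * g (suc (suc j)) + (1 * g (suc j) + Σℕ< (suc j) (λ i → fib (suc (suc (suc i))) * g (j ∸ i)))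
    ≡⟨ cong (λ z → 1 * g (suc (suc j)) + (1 * g (suc j) + z)) fib-split ⟩
  1 * g (suc (suc j)) + (1 * g (suc j) + (P + convFib (suc s) j))
    ≡⟨ rearrange (g (suc (suc j))) (g (suc j)) P (convFib (suc s) j) ⟩
  (1 * g (suc j) + P) + convFib (suc s) j + g (suc (suc j))
    ≡⟨ cong (λ z → z + convFib (suc s) j + g (suc (suc j))) (Σℕ<-suc (suc j) (λ i → fib (suc i) * g (suc j ∸ i))) ⟨
  convFib (suc s) (suc j) + convFib (suc s) j + convFib s (suc (suc j)) ∎
  where
  open ≡-Reasoning
  g : ℕ → ℕ
  g = convFib s
  P : ℕ
  P = Σℕ< (suc j) (λ i → fib (suc (suc i)) * g (j ∸ i))
  fib-split : Σℕ< (suc j) (λ i → fib (suc (suc (suc i))) * g (j ∸ i)) ≡ P + convFib (suc s) j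
  fib-split = trans (Σℕ<-cong (suc j) _ _ (λ i _ → *-distribʳ-+ (g (j ∸ i)) (fib (suc (suc i))) (fib (suc i))))
                    (Σℕ<-distrib-+ (suc j) _ _)
  rearrange : ∀ a b p q → 1 * a + (1 * b + (p + q)) ≡ (1 * b + p) + q + a
  rearrange = solve-∀

convFib[r,0]≡1 : ∀ r → convFib r 0 ≡ 1
convFib[r,0]≡1 zero = refl
convFib[r,0]≡1 (suc r) = trans (+-identityʳ (convFib r 0)) (convFib[r,0]≡1 r)

convFib[r,1]≡r : ∀ r → convFib r 1 ≡ r
convFib[r,1]≡r zero = refl
convFib[r,1]≡r (suc r) = begin
  (0 + 1 * convFib r 1) + 1 * convFib r 0
    ≡⟨ cong₂ (λ a b → (0 + 1 * a) + 1 * b) (convFib[r,1]≡r r) (convFib[r,0]≡1 r) ⟩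
  (0 + 1 * r) + 1 * 1
    ≡⟨ normalise r ⟩
  suc r ∎
  where
  open ≡-Reasoning
  normalise : ∀ r → (0 + 1 * r) + 1 * 1 ≡ suc r
  normalise = solve-∀

2*convFib[r,2]≡r*[r+3] : ∀ r → 2 * convFib r 2 ≡ r * (r + 3)
2*convFib[r,2]≡r*[r+3] zero = refl
2*convFib[r,2]≡r*[r+3] (suc s) = begin
  2 * convFib (suc s) 2
    ≡⟨ cong (2 *_) (convFib-suc-recurrence s 0) ⟩
  2 * (convFib (suc s) 1 + convFib (suc s) 0 + convFib s 2)
    ≡⟨ cong₂ (λ a b → 2 * (a + b + convFib s 2)) (convFib[r,1]≡r (suc s)) (convFib[r,0]≡1 (suc s)) ⟩
  2 * (suc s + 1 + convFib s 2)
    ≡⟨ *-distribˡ-+ 2 (suc s + 1) (convFib s 2) ⟩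
  2 * (suc s + 1) + 2 * convFib s 2
    ≡⟨ cong (λ z → 2 * (suc s + 1) + z) (2*convFib[r,2]≡r*[r+3] s) ⟩
  2 * (suc s + 1) + s * (s + 3)
    ≡⟨ normalise s ⟩
  suc s * (suc s + 3) ∎
  where
  open ≡-Reasoning
  normalise : ∀ s → 2 * (suc s + 1) + s * (s + 3) ≡ suc s * (suc s + 3)
  normalise = solve-∀

-- The coefficient of z^j in (1 + 2z) G_r' + 4r G_r = 5r G_(r+1).  Both sides satisfy the
-- recurrence of convFib-suc-recurrence up to the same inhomogeneous term 5 G_(s+1)(j+2).
convFib-raise : ∀ r j → suc j * convFib r (suc j) + (2 * j + 4 * r) * convFib r j ≡ 5 * r * convFib (suc r) j
convFib-raise zero zero = refl
convFib-raise zero (suc j) = cong₂ _+_ (*-zeroʳ (suc (suc j))) (*-zeroʳ (2 * suc j + 0))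
convFib-raise (suc s) j = proj₁ (consecutive j)
  where
  open ≡-Reasoning
  r : ℕ
  r = suc s
  L R : ℕ → ℕ → ℕ
  L n i = suc i * convFib n (suc i) + (2 * i + 4 * n) * convFib n i
  R n i = 5 * n * convFib (suc n) i

  L-recurrence : ∀ j → L r (suc (suc j)) ≡ L r (suc j) + L r j + L s (suc (suc j)) + 5 * convFib r (suc (suc j))
  L-recurrence j = linear (convFib-suc-recurrence s j) (convFib-suc-recurrence s (suc j))
    where
    identity : ∀ j s g0 g1 h2 h3 →
      (3 + j) * ((g1 + g0 + h2) + g1 + h3) + (2 * (2 + j) + 4 * (1 + s)) * (g1 + g0 + h2)
      ≡ ((2 + j) * (g1 + g0 + h2) + (2 * (1 + j) + 4 * (1 + s)) * g1)
        + ((1 + j) * g1 + (2 * j + 4 * (1 + s)) * g0)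
        + ((3 + j) * h3 + (2 * (2 + j) + 4 * s) * h2)
        + 5 * (g1 + g0 + h2)
    identity = solve-∀
    linear : ∀ {g0 g1 g2 g3 h2 h3} → g2 ≡ g1 + g0 + h2 → g3 ≡ g2 + g1 + h3 →
      (3 + j) * g3 + (2 * (2 + j) + 4 * r) * g2
      ≡ ((2 + j) * g2 + (2 * (1 + j) + 4 * r) * g1) + ((1 + j) * g1 + (2 * j + 4 * r) * g0)
        + ((3 + j) * h3 + (2 * (2 + j) + 4 * s) * h2) + 5 * g2
    linear {g0} {g1} {h2 = h2} {h3} refl refl = identity j s g0 g1 h2 h3

  R-recurrence : ∀ j → R r (suc (suc j)) ≡ R r (suc j) + R r j + R s (suc (suc j)) + 5 * convFib r (suc (suc j))
  R-recurrence j = trans (cong (5 * r *_) (convFib-suc-recurrence r j))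
                         (identity s (convFib (suc r) (suc j)) (convFib (suc r) j) (convFib r (suc (suc j))))
    where
    identity : ∀ s a b c → 5 * (1 + s) * (a + b + c) ≡ 5 * (1 + s) * a + 5 * (1 + s) * b + 5 * s * c + 5 * c
    identity = solve-∀

  L≡R-0 : L r 0 ≡ R r 0
  L≡R-0 = begin
    1 * convFib r 1 + (0 + 4 * r) * convFib r 0
      ≡⟨ cong₂ (λ a b → 1 * a + (0 + 4 * r) * b) (convFib[r,1]≡r r) (convFib[r,0]≡1 r) ⟩
    1 * r + (0 + 4 * r) * 1
      ≡⟨ identity r ⟩
    5 * r * 1
      ≡⟨ cong (5 * r *_) (convFib[r,0]≡1 (suc r)) ⟨
    5 * r * convFib (suc r) 0 ∎
    where
    identity : ∀ r → 1 * r + (0 + 4 * r) * 1 ≡ 5 * r * 1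
    identity = solve-∀

  L≡R-1 : L r 1 ≡ R r 1
  L≡R-1 = begin
    2 * convFib r 2 + (2 * 1 + 4 * r) * convFib r 1
      ≡⟨ cong₂ (λ a b → a + (2 * 1 + 4 * r) * b) (2*convFib[r,2]≡r*[r+3] r) (convFib[r,1]≡r r) ⟩
    r * (r + 3) + (2 * 1 + 4 * r) * r
      ≡⟨ identity r ⟩
    5 * r * suc r
      ≡⟨ cong (5 * r *_) (convFib[r,1]≡r (suc r)) ⟨
    5 * r * convFib (suc r) 1 ∎
    where
    identity : ∀ r → r * (r + 3) + (2 * 1 + 4 * r) * r ≡ 5 * r * (1 + r)
    identity = solve-∀

  consecutive : ∀ i → (L r i ≡ R r i) × (L r (suc i) ≡ R r (suc i))
  consecutive zero = L≡R-0 , L≡R-1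
  consecutive (suc i) with consecutive i
  ... | L≡R-i , L≡R-i+1 = L≡R-i+1 , (begin
    L r (suc (suc i))
      ≡⟨ L-recurrence i ⟩
    L r (suc i) + L r i + L s (suc (suc i)) + 5 * convFib r (suc (suc i))
      ≡⟨ cong₂ (λ a b → a + b + L s (suc (suc i)) + 5 * convFib r (suc (suc i))) L≡R-i+1 L≡R-i ⟩
    R r (suc i) + R r i + L s (suc (suc i)) + 5 * convFib r (suc (suc i))
      ≡⟨ cong (λ c → R r (suc i) + R r i + c + 5 * convFib r (suc (suc i))) (convFib-raise s (suc (suc i))) ⟩
    R r (suc i) + R r i + R s (suc (suc i)) + 5 * convFib r (suc (suc i))
      ≡⟨ R-recurrence i ⟨
    R r (suc (suc i)) ∎)

-- The closed form

fibLucas : ℕ → ℕ → ℕ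
fibLucas zero t = fib t
fibLucas (suc zero) t = lucas t
fibLucas (suc (suc m)) t = 5 * fibLucas m t

private
  step-identity : ∀ a b → ((b + a) + b) + 2 * (b + a) ≡ ((b + a) + 2 * b) + (b + 2 * a)
  step-identity = solve-∀

fib[1+t]+2*fib[t]≡lucas[1+t] : ∀ t → fib (suc t) + 2 * fib t ≡ lucas (suc t)
fib[1+t]+2*fib[t]≡lucas[1+t] zero = refl
fib[1+t]+2*fib[t]≡lucas[1+t] (suc zero) = refl
fib[1+t]+2*fib[t]≡lucas[1+t] (suc (suc t)) =
  trans (step-identity (fib t) (fib (suc t)))
        (cong₂ _+_ (fib[1+t]+2*fib[t]≡lucas[1+t] (suc t)) (fib[1+t]+2*fib[t]≡lucas[1+t] t))

lucas[1+t]+2*lucas[t]≡5*fib[1+t] : ∀ t → lucas (suc t) + 2 * lucas t ≡ 5 * fib (suc t)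
lucas[1+t]+2*lucas[t]≡5*fib[1+t] zero = refl
lucas[1+t]+2*lucas[t]≡5*fib[1+t] (suc zero) = refl
lucas[1+t]+2*lucas[t]≡5*fib[1+t] (suc (suc t)) =
  trans (step-identity (lucas t) (lucas (suc t)))
        (trans (cong₂ _+_ (lucas[1+t]+2*lucas[t]≡5*fib[1+t] (suc t)) (lucas[1+t]+2*lucas[t]≡5*fib[1+t] t))
               (sym (*-distribˡ-+ 5 (fib (suc (suc t))) (fib (suc t)))))

fibLucas-step : ∀ m t → fibLucas m (suc t) + 2 * fibLucas m t ≡ fibLucas (suc m) (suc t)
fibLucas-step zero t = fib[1+t]+2*fib[t]≡lucas[1+t] t
fibLucas-step (suc zero) t = lucas[1+t]+2*lucas[t]≡5*fib[1+t] t
fibLucas-step (suc (suc m)) t =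
  trans (identity (fibLucas m (suc t)) (fibLucas m t)) (cong (5 *_) (fibLucas-step m t))
  where
  identity : ∀ x y → 5 * x + 2 * (5 * y) ≡ 5 * (x + 2 * y)
  identity = solve-∀

fibLucas-even : ∀ h t → fibLucas (h + h) t ≡ 5 ^ h * fib t
fibLucas-even zero t = sym (+-identityʳ (fib t))
fibLucas-even (suc h) t rewrite +-suc h h =
  trans (cong (5 *_) (fibLucas-even h t)) (sym (*-assoc 5 (5 ^ h) (fib t)))

fibLucas-odd : ∀ h t → fibLucas (suc (h + h)) t ≡ 5 ^ h * lucas t
fibLucas-odd zero t = sym (+-identityʳ (lucas t))
fibLucas-odd (suc h) t rewrite +-suc h h =
  trans (cong (5 *_) (fibLucas-odd h t)) (sym (*-assoc 5 (5 ^ h) (lucas t)))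

term : ℕ → ℕ → ℕ
term m j = ((m + j) C j) * fibLucas m (suc (m + j))

term-raise : ∀ m j → suc j * term m (suc j) + (2 * j + 2 * m + 2) * term m j ≡ suc m * term (suc m) j
term-raise m j = begin
  suc j * term m (suc j) + (2 * j + 2 * m + 2) * term m j
    ≡⟨ cong (λ z → suc j * z + (2 * j + 2 * m + 2) * term m j) term-suc ⟩
  suc j * (c′ * y′) + (2 * j + 2 * m + 2) * (c * y)
    ≡⟨ cong (_+ (2 * j + 2 * m + 2) * (c * y)) (*-assoc (suc j) c′ y′) ⟨
  (suc j * c′) * y′ + (2 * j + 2 * m + 2) * (c * y)
    ≡⟨ cong (λ z → z * y′ + (2 * j + 2 * m + 2) * (c * y)) ([k+1]*[n+1]C[k+1]≡[n+1]*nCk (m + j) j) ⟩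
  (suc (m + j) * c) * y′ + (2 * j + 2 * m + 2) * (c * y)
    ≡⟨ identity j m c y′ y ⟩
  (suc (m + j) * c) * (y′ + 2 * y)
    ≡⟨ cong ((suc (m + j) * c) *_) (fibLucas-step m (suc (m + j))) ⟩
  (suc (m + j) * c) * fibLucas (suc m) (suc (suc (m + j)))
    ≡⟨ cong (_* fibLucas (suc m) (suc (suc (m + j)))) ([a+1]*[a+1+k]Ck≡[a+1+k]*[a+k]Ck m j) ⟨
  (suc m * ((suc m + j) C j)) * fibLucas (suc m) (suc (suc (m + j)))
    ≡⟨ *-assoc (suc m) ((suc m + j) C j) (fibLucas (suc m) (suc (suc (m + j)))) ⟩
  suc m * term (suc m) j ∎
  where
  open ≡-Reasoning
  c′ y′ c y : ℕ
  c′ = suc (m + j) C suc j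
  y′ = fibLucas m (suc (suc (m + j)))
  c = (m + j) C j
  y = fibLucas m (suc (m + j))
  term-suc : term m (suc j) ≡ c′ * y′
  term-suc rewrite +-suc m j = refl
  identity : ∀ j m c y′ y → (suc (m + j) * c) * y′ + (2 * j + 2 * m + 2) * (c * y) ≡ (suc (m + j) * c) * (y′ + 2 * y)
  identity = solve-∀

weight : ℕ → ℕ → ℕ
weight m d = (m + d + d) C d

weight-raise : ∀ m e →
  (m + suc e) * weight m (suc e) ≡ m * weight (pred m) (suc e) + (2 * m + 4 * e + 2) * weight m e
weight-raise m e = begin
  (m + suc e) * weight m (suc e)
    ≡⟨ cong₂ _*_ (+-suc m e) (cong (_C suc e) (index m e)) ⟩
  suc (m + e) * (suc (suc N) C suc e)
    ≡⟨ cong (suc (m + e) *_) (nCk+nC[k+1]≡[n+1]C[k+1] (suc N) e) ⟨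
  suc (m + e) * (x + y)
    ≡⟨ distribute m e x y ⟩
  suc (m + e) * x + (m * y + suc e * y)
    ≡⟨ cong₂ (λ u v → u + (m * y + v)) ([a+1]*[a+1+k]Ck≡[a+1+k]*[a+k]Ck (m + e) e) ([k+1]*[n+1]C[k+1]≡[n+1]*nCk N e) ⟩
  suc N * c + (m * y + suc N * c)
    ≡⟨ collect m e y c ⟩
  m * y + (2 * m + 4 * e + 2) * c
    ≡⟨ cong (_+ (2 * m + 4 * e + 2) * c) (pred-weight m) ⟨
  m * weight (pred m) (suc e) + (2 * m + 4 * e + 2) * weight m e ∎
  where
  open ≡-Reasoning
  N x y c : ℕ
  N = m + e + e
  x = suc N C e
  y = suc N C suc e
  c = N C e
  index : ∀ m e → m + suc e + suc e ≡ suc (suc (m + e + e))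
  index = solve-∀
  pred-weight : ∀ m → m * weight (pred m) (suc e) ≡ m * (suc (m + e + e) C suc e)
  pred-weight zero = refl
  pred-weight (suc m) = cong (λ n → suc m * (n C suc e)) (index m e)
  distribute : ∀ m e x y → suc (m + e) * (x + y) ≡ suc (m + e) * x + (m * y + suc e * y)
  distribute = solve-∀
  collect : ∀ m e y c → suc (m + e + e) * c + (m * y + suc (m + e + e) * c) ≡ m * y + (2 * m + 4 * e + 2) * c
  collect = solve-∀

Σantidiagonal : ℕ → (ℕ → ℕ → ℕ) → ℕ
Σantidiagonal zero f = f 0 0
Σantidiagonal (suc p) f = f 0 (suc p) + Σantidiagonal p (λ m d → f (suc m) d)

Σantidiagonal-cong : ∀ p f g → (∀ m d → m + d ≡ p → f m d ≡ g m d) → Σantidiagonal p f ≡ Σantidiagonal p g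
Σantidiagonal-cong zero f g f≗g = f≗g 0 0 refl
Σantidiagonal-cong (suc p) f g f≗g =
  cong₂ _+_ (f≗g 0 (suc p) refl) (Σantidiagonal-cong p _ _ (λ m d m+d≡p → f≗g (suc m) d (cong suc m+d≡p)))

Σantidiagonal-distrib-+ : ∀ p f g →
  Σantidiagonal p (λ m d → f m d + g m d) ≡ Σantidiagonal p f + Σantidiagonal p g
Σantidiagonal-distrib-+ zero f g = refl
Σantidiagonal-distrib-+ (suc p) f g =
  trans (cong (λ z → f 0 (suc p) + g 0 (suc p) + z) (Σantidiagonal-distrib-+ p _ _))
        (ℕ+.interchange (f 0 (suc p)) (g 0 (suc p)) _ _)

*-distribˡ-Σantidiagonal : ∀ p c f → c * Σantidiagonal p f ≡ Σantidiagonal p (λ m d → c * f m d)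
*-distribˡ-Σantidiagonal zero c f = refl
*-distribˡ-Σantidiagonal (suc p) c f =
  trans (*-distribˡ-+ c (f 0 (suc p)) _) (cong (λ z → c * f 0 (suc p) + z) (*-distribˡ-Σantidiagonal p c _))

Σantidiagonal-suc : ∀ p f → Σantidiagonal (suc p) f ≡ f (suc p) 0 + Σantidiagonal p (λ m d → f m (suc d))
Σantidiagonal-suc zero f = +-comm (f 0 1) (f 1 0)
Σantidiagonal-suc (suc p) f =
  trans (cong (λ z → f 0 (suc (suc p)) + z) (Σantidiagonal-suc p (λ m d → f (suc m) d)))
        (ℕ+.x∙yz≈y∙xz (f 0 (suc (suc p))) (f (suc (suc p)) 0) _)

Σantidiagonal≡Σℕ< : ∀ p f → Σantidiagonal p f ≡ Σℕ< (suc p) (λ k → f (p ∸ k) k)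
Σantidiagonal≡Σℕ< zero f = refl
Σantidiagonal≡Σℕ< (suc p) f = begin
  f 0 (suc p) + Σantidiagonal p (λ m d → f (suc m) d)
    ≡⟨ cong (λ z → f 0 (suc p) + z) (Σantidiagonal≡Σℕ< p _) ⟩
  f 0 (suc p) + Σℕ< (suc p) (λ k → f (suc (p ∸ k)) k)
    ≡⟨ cong (λ z → f 0 (suc p) + z)
            (Σℕ<-cong (suc p) _ _ (λ k k<1+p → cong (λ m → f m k) (sym (+-∸-assoc 1 (≤-pred k<1+p))))) ⟩
  f 0 (suc p) + Σℕ< (suc p) (λ k → f (suc p ∸ k) k)
    ≡⟨ +-comm (f 0 (suc p)) _ ⟩
  Σℕ< (suc p) (λ k → f (suc p ∸ k) k) + f 0 (suc p)
    ≡⟨ cong (λ m → Σℕ< (suc p) (λ k → f (suc p ∸ k) k) + f m (suc p)) (n∸n≡0 p) ⟨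
  Σℕ< (suc (suc p)) (λ k → f (suc p ∸ k) k) ∎
  where open ≡-Reasoning

closedForm : ℕ → ℕ → ℕ
closedForm p j = Σantidiagonal p (λ m d → weight m d * term m j)

closedForm-raise : ∀ q j →
  suc j * closedForm q (suc j) + (2 * j + 4 * suc q) * closedForm q j ≡ suc q * closedForm (suc q) j
closedForm-raise q j = begin
  suc j * closedForm q (suc j) + (2 * j + 4 * suc q) * closedForm q j
    ≡⟨ cong₂ _+_ (*-distribˡ-Σantidiagonal q (suc j) W′) (*-distribˡ-Σantidiagonal q (2 * j + 4 * suc q) W) ⟩
  Σantidiagonal q (λ m d → suc j * W′ m d) + Σantidiagonal q (λ m d → (2 * j + 4 * suc q) * W m d)
    ≡⟨ Σantidiagonal-distrib-+ q _ _ ⟨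
  Σantidiagonal q (λ m d → suc j * W′ m d + (2 * j + 4 * suc q) * W m d)
    ≡⟨ Σantidiagonal-cong q _ _ split-term ⟩
  Σantidiagonal q (λ m d → V (suc m) d + K m d)
    ≡⟨ Σantidiagonal-distrib-+ q _ K ⟩
  Σantidiagonal q (λ m d → V (suc m) d) + Σantidiagonal q K
    ≡⟨ cong (λ z → Σantidiagonal q (λ m d → V (suc m) d) + z) (Σantidiagonal-suc q K₊) ⟨
  Σantidiagonal (suc q) V + Σantidiagonal (suc q) K₊
    ≡⟨ Σantidiagonal-distrib-+ (suc q) V K₊ ⟨
  Σantidiagonal (suc q) (λ m d → V m d + K₊ m d)
    ≡⟨ Σantidiagonal-cong (suc q) _ _ (λ m d m+d≡1+q → trans (merge m d) (cong (_* W m d) m+d≡1+q)) ⟩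
  Σantidiagonal (suc q) (λ m d → suc q * W m d)
    ≡⟨ *-distribˡ-Σantidiagonal (suc q) (suc q) W ⟨
  suc q * closedForm (suc q) j ∎
  where
  open ≡-Reasoning
  W W′ K K₊ V : ℕ → ℕ → ℕ
  W m d = weight m d * term m j
  W′ m d = weight m d * term m (suc j)
  K m d = (2 * m + 4 * d + 2) * W m d
  K₊ m zero = 0
  K₊ m (suc d) = K m d
  V m d = m * (weight (pred m) d * term m j)

  split-term : ∀ m d → m + d ≡ q → suc j * W′ m d + (2 * j + 4 * suc q) * W m d ≡ V (suc m) d + K m d
  split-term m d refl = begin
    suc j * (w * t′) + (2 * j + 4 * suc (m + d)) * (w * t)
      ≡⟨ identity j m d w t′ t ⟩
    w * (suc j * t′ + (2 * j + 2 * m + 2) * t) + K m d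
      ≡⟨ cong (λ z → w * z + K m d) (term-raise m j) ⟩
    w * (suc m * term (suc m) j) + K m d
      ≡⟨ cong (_+ K m d) (ℕ*.x∙yz≈y∙xz w (suc m) (term (suc m) j)) ⟩
    V (suc m) d + K m d ∎
    where
    w t′ t : ℕ
    w = weight m d
    t′ = term m (suc j)
    t = term m j
    identity : ∀ j m d w t′ t → suc j * (w * t′) + (2 * j + 4 * suc (m + d)) * (w * t)
                              ≡ w * (suc j * t′ + (2 * j + 2 * m + 2) * t) + (2 * m + 4 * d + 2) * (w * t)
    identity = solve-∀

  merge : ∀ m d → V m d + K₊ m d ≡ (m + d) * W m d
  merge m zero = begin
    m * (weight (pred m) 0 * term m j) + 0
      ≡⟨ +-identityʳ _ ⟩
    m * (weight (pred m) 0 * term m j)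
      ≡⟨ cong (λ c → m * (c * term m j)) (trans (nC0≡1 (pred m + 0 + 0)) (sym (nC0≡1 (m + 0 + 0)))) ⟩
    m * W m 0
      ≡⟨ cong (_* W m 0) (+-identityʳ m) ⟨
    (m + 0) * W m 0 ∎
  merge m (suc e) = begin
    m * (weight (pred m) (suc e) * T) + (2 * m + 4 * e + 2) * (weight m e * T)
      ≡⟨ cong₂ _+_ (*-assoc m _ T) (*-assoc (2 * m + 4 * e + 2) _ T) ⟨
    m * weight (pred m) (suc e) * T + (2 * m + 4 * e + 2) * weight m e * T
      ≡⟨ *-distribʳ-+ T (m * weight (pred m) (suc e)) _ ⟨
    (m * weight (pred m) (suc e) + (2 * m + 4 * e + 2) * weight m e) * T
      ≡⟨ cong (_* T) (weight-raise m e) ⟨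
    (m + suc e) * weight m (suc e) * T
      ≡⟨ *-assoc (m + suc e) _ T ⟩
    (m + suc e) * W m (suc e) ∎
    where
    T : ℕ
    T = term m j

5^p*convFib[1+p]≡closedForm : ∀ p j → 5 ^ p * convFib (suc p) j ≡ closedForm p j
5^p*convFib[1+p]≡closedForm zero j = begin
  1 * convFib 1 j      ≡⟨ *-identityˡ _ ⟩
  convFib 1 j          ≡⟨ convFib[1,j]≡fib[1+j] j ⟩
  fib (suc j)          ≡⟨ *-identityˡ _ ⟨
  1 * fib (suc j)      ≡⟨ cong (_* fib (suc j)) (nCn≡1 j) ⟨
  (j C j) * fib (suc j) ≡⟨ *-identityˡ _ ⟨
  closedForm zero j    ∎
  where open ≡-Reasoning
5^p*convFib[1+p]≡closedForm (suc q) j = *-cancelˡ-≡ _ _ (suc q) (begin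
  suc q * (5 ^ suc q * convFib (suc r) j)
    ≡⟨ identity q (5 ^ q) (convFib (suc r) j) ⟩
  5 ^ q * (5 * r * convFib (suc r) j)
    ≡⟨ cong (5 ^ q *_) (convFib-raise r j) ⟨
  5 ^ q * (suc j * convFib r (suc j) + (2 * j + 4 * r) * convFib r j)
    ≡⟨ distribute (5 ^ q) j r _ _ ⟩
  suc j * (5 ^ q * convFib r (suc j)) + (2 * j + 4 * r) * (5 ^ q * convFib r j)
    ≡⟨ cong₂ (λ a b → suc j * a + (2 * j + 4 * r) * b)
             (5^p*convFib[1+p]≡closedForm q (suc j)) (5^p*convFib[1+p]≡closedForm q j) ⟩
  suc j * closedForm q (suc j) + (2 * j + 4 * r) * closedForm q j
    ≡⟨ closedForm-raise q j ⟩
  suc q * closedForm (suc q) j ∎)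
  where
  open ≡-Reasoning
  r : ℕ
  r = suc q
  identity : ∀ q a G → suc q * (5 * a * G) ≡ a * (5 * suc q * G)
  identity = solve-∀
  distribute : ∀ a j r x y → a * (suc j * x + (2 * j + 4 * r) * y) ≡ suc j * (a * x) + (2 * j + 4 * r) * (a * y)
  distribute = solve-∀

-- The right-hand side

even⊎odd : ∀ m → Σ ℕ (λ h → m ≡ h + h) ⊎ Σ ℕ (λ h → m ≡ suc (h + h))
even⊎odd zero = inj₁ (0 , refl)
even⊎odd (suc m) with even⊎odd m
... | inj₁ (h , refl) = inj₂ (h , refl)
... | inj₂ (h , refl) = inj₁ (suc h , cong suc (sym (+-suc h h)))

/5^-rescale : ∀ {a b} h {e p} → 5 ^ h * a ≡ b → h + e ≡ p → a /5^ e ≡ b /5^ p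
/5^-rescale {a} h {e} refl refl =
  *≡*⇒/≡ a (5 ^ h * a) (5 ^ e) (5 ^ (h + e)) {{m^n≢0 5 e}} {{m^n≢0 5 (h + e)}}
    (trans (cong (a *_) (^-distribˡ-+-* 5 h e)) (ℕ*.x∙yz≈yx∙z a (5 ^ h) (5 ^ e)))

lucasTerm fibTerm : ℕ → ℕ → ℕ → ℚ
lucasTerm r j k = (((r + k ∸ 1) C k) * ((r ∸ k + j ∸ 1) C j) * lucas (r ∸ k + j)) /5^ ((k + r) ℕ./ 2)
fibTerm r j k = (((r + k ∸ 1) C k) * ((r ∸ k + j ∸ 1) C j) * fib (r ∸ k + j)) /5^ ((k + r ∸ 1) ℕ./ 2)

lucasSummand fibSummand : ℕ → ℕ → ℕ → ℚ
lucasSummand r j k = if (r + k) % 2 ≡ᵇ 0 then lucasTerm r j k else ℚ.0ℚ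
fibSummand r j k = if (r + k) % 2 ≡ᵇ 1 then fibTerm r j k else ℚ.0ℚ

summands[odd]≡fibTerm : ∀ r j k → (r + k) % 2 ≡ 1 → lucasSummand r j k ℚ.+ fibSummand r j k ≡ fibTerm r j k
summands[odd]≡fibTerm r j k odd = begin
  lucasSummand r j k ℚ.+ fibSummand r j k
    ≡⟨ cong₂ ℚ._+_ (cong (λ b → if b ≡ᵇ 0 then lucasTerm r j k else ℚ.0ℚ) odd)
                   (cong (λ b → if b ≡ᵇ 1 then fibTerm r j k else ℚ.0ℚ) odd) ⟩
  ℚ.0ℚ ℚ.+ fibTerm r j k
    ≡⟨ ℚP.+-identityˡ (fibTerm r j k) ⟩
  fibTerm r j k ∎
  where open ≡-Reasoning

summands[even]≡lucasTerm : ∀ r j k → (r + k) % 2 ≡ 0 → lucasSummand r j k ℚ.+ fibSummand r j k ≡ lucasTerm r j k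
summands[even]≡lucasTerm r j k even = begin
  lucasSummand r j k ℚ.+ fibSummand r j k
    ≡⟨ cong₂ ℚ._+_ (cong (λ b → if b ≡ᵇ 0 then lucasTerm r j k else ℚ.0ℚ) even)
                   (cong (λ b → if b ≡ᵇ 1 then fibTerm r j k else ℚ.0ℚ) even) ⟩
  lucasTerm r j k ℚ.+ ℚ.0ℚ
    ≡⟨ ℚP.+-identityʳ (lucasTerm r j k) ⟩
  lucasTerm r j k ∎
  where open ≡-Reasoning

summand-rescale : ∀ j m k h e (g : ℕ → ℕ) → (∀ t → fibLucas m t ≡ 5 ^ h * g t) → h + e ≡ m + k →
  (((suc (m + k) + k ∸ 1) C k) * ((suc (m + k) ∸ k + j ∸ 1) C j) * g (suc (m + k) ∸ k + j)) /5^ e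
  ≡ (weight m k * term m j) /5^ (m + k)
summand-rescale j m k h e g fibLucas≡5^h*g h+e≡m+k = begin
  (((suc (m + k) + k ∸ 1) C k) * ((suc (m + k) ∸ k + j ∸ 1) C j) * g (suc (m + k) ∸ k + j)) /5^ e
    ≡⟨ cong (λ n → (weight m k * ((n + j ∸ 1) C j) * g (n + j)) /5^ e) (m+n∸n≡m (suc m) k) ⟩
  (weight m k * c * g (suc (m + j))) /5^ e
    ≡⟨ /5^-rescale h (trans (move-power (5 ^ h) (weight m k) c _)
                            (cong (λ y → weight m k * (c * y)) (sym (fibLucas≡5^h*g _))))
                     h+e≡m+k ⟩
  (weight m k * term m j) /5^ (m + k) ∎
  where
  open ≡-Reasoning
  c : ℕ
  c = (m + j) C j
  move-power : ∀ a w c f → a * (w * c * f) ≡ w * (c * (a * f))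
  move-power = solve-∀

summands≡closedForm-term-even : ∀ j h k →
  lucasSummand (suc (h + h + k)) j k ℚ.+ fibSummand (suc (h + h + k)) j k
  ≡ (weight (h + h) k * term (h + h) j) /5^ (h + h + k)
summands≡closedForm-term-even j h k =
  trans (summands[odd]≡fibTerm (suc (h + h + k)) j k parity)
        (summand-rescale j (h + h) k h ((k + suc (h + h + k) ∸ 1) ℕ./ 2) fib (fibLucas-even h)
                         (trans (cong (_+_ h) exponent) (sym (+-assoc h h k))))
  where
  parity : (suc (h + h + k) + k) % 2 ≡ 1
  parity = trans (cong (_% 2) (twice h k)) ([m+kn]%n≡m%n 1 (h + k) 2)
    where
    twice : ∀ h k → suc (h + h + k) + k ≡ 1 + (h + k) * 2
    twice = solve-∀
  exponent : (k + suc (h + h + k) ∸ 1) ℕ./ 2 ≡ h + k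
  exponent = trans (cong (λ n → (n ∸ 1) ℕ./ 2) (+-suc k (h + h + k)))
                   (trans (cong (ℕ._/ 2) (twice h k)) (m*n/n≡m (h + k) 2))
    where
    twice : ∀ h k → k + (h + h + k) ≡ (h + k) * 2
    twice = solve-∀

summands≡closedForm-term-odd : ∀ j h k →
  lucasSummand (suc (suc (h + h) + k)) j k ℚ.+ fibSummand (suc (suc (h + h) + k)) j k
  ≡ (weight (suc (h + h)) k * term (suc (h + h)) j) /5^ (suc (h + h) + k)
summands≡closedForm-term-odd j h k =
  trans (summands[even]≡lucasTerm (suc (suc (h + h) + k)) j k parity)
        (summand-rescale j (suc (h + h)) k h ((k + suc (suc (h + h) + k)) ℕ./ 2) lucas (fibLucas-odd h)
                         (trans (cong (_+_ h) exponent) (trans (+-suc h (h + k)) (cong suc (sym (+-assoc h h k))))))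
  where
  parity : (suc (suc (h + h) + k) + k) % 2 ≡ 0
  parity = trans (cong (_% 2) (twice h k)) ([m+kn]%n≡m%n 0 (suc (h + k)) 2)
    where
    twice : ∀ h k → suc (suc (h + h + k)) + k ≡ 0 + suc (h + k) * 2
    twice = solve-∀
  exponent : (k + suc (suc (h + h) + k)) ℕ./ 2 ≡ suc (h + k)
  exponent = trans (cong (ℕ._/ 2) (twice h k)) (m*n/n≡m (suc (h + k)) 2)
    where
    twice : ∀ h k → k + suc (suc (h + h + k)) ≡ suc (h + k) * 2
    twice = solve-∀

-- Only one of the two summands at index k is non-zero, according to the parity of m = p - k;
-- it is the term of closedForm p j at (m, k) divided by 5^p.
summands≡closedForm-term : ∀ j m k {p} → m + k ≡ p →
  lucasSummand (suc p) j k ℚ.+ fibSummand (suc p) j k ≡ (weight m k * term m j) /5^ p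
summands≡closedForm-term j m k refl = by-parity m (even⊎odd m)
  where
  by-parity : ∀ m → Σ ℕ (λ h → m ≡ h + h) ⊎ Σ ℕ (λ h → m ≡ suc (h + h)) →
    lucasSummand (suc (m + k)) j k ℚ.+ fibSummand (suc (m + k)) j k ≡ (weight m k * term m j) /5^ (m + k)
  by-parity .(h + h) (inj₁ (h , refl)) = summands≡closedForm-term-even j h k
  by-parity .(suc (h + h)) (inj₂ (h , refl)) = summands≡closedForm-term-odd j h k

convFib≡rhs : ∀ p j → + convFib (suc p) j / 1 ≡ rhs (suc p) j
convFib≡rhs p j = begin
  + convFib (suc p) j / 1
    ≡⟨ *≡*⇒/≡ (convFib (suc p) j) (closedForm p j) 1 (5 ^ p) {{_}} {{m^n≢0 5 p}}
              (trans (*-comm _ (5 ^ p)) (trans (5^p*convFib[1+p]≡closedForm p j) (sym (*-identityʳ _)))) ⟩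
  closedForm p j /5^ p
    ≡⟨ cong (_/5^ p) (Σantidiagonal≡Σℕ< p _) ⟩
  Σℕ< (suc p) c /5^ p
    ≡⟨ Σℚ<+Σℚ<≡Σℕ</ (suc p) (lucasSummand (suc p) j) (fibSummand (suc p) j) c (5 ^ p) {{m^n≢0 5 p}}
                   (λ k k<1+p → summands≡closedForm-term j (p ∸ k) k (m∸n+n≡m (≤-pred k<1+p))) ⟨
  rhs (suc p) j ∎
  where
  open ≡-Reasoning
  c : ℕ → ℕ
  c k = weight (p ∸ k) k * term (p ∸ k) j

-- The cases r = 2 and r = 3

[1+n]Cn≡1+n : ∀ n → suc n C n ≡ suc n
[1+n]Cn≡1+n n = trans (nCk≡nC[n∸k] (n≤1+n n)) (trans (cong (suc n C_) (m+n∸n≡m 1 n)) (nC1≡n (suc n)))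

convFib[2,j]-formula : ∀ j → 5 * convFib 2 j ≡ (j + 1) * lucas (j + 2) + 2 * fib (j + 1)
convFib[2,j]-formula j rewrite +-comm j 1 | +-comm j 2 = begin
  5 * convFib 2 j
    ≡⟨ 5^p*convFib[1+p]≡closedForm 1 j ⟩
  2 * ((j C j) * F₁) + 1 * ((suc j C j) * L₂)
    ≡⟨ cong₂ (λ a b → 2 * (a * F₁) + 1 * (b * L₂)) (nCn≡1 j) ([1+n]Cn≡1+n j) ⟩
  2 * (1 * F₁) + 1 * (suc j * L₂)
    ≡⟨ identity F₁ L₂ (suc j) ⟩
  suc j * L₂ + 2 * F₁ ∎
  where
  open ≡-Reasoning
  F₁ L₂ : ℕ
  F₁ = fib (suc j)
  L₂ = lucas (suc (suc j))
  identity : ∀ F L s → 2 * (1 * F) + 1 * (s * L) ≡ s * L + 2 * F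
  identity = solve-∀

convFib[3,j]-formula : ∀ j →
  50 * convFib 3 j ≡ 5 * (j + 1) * (j + 2) * fib (j + 3) + 6 * (j + 1) * lucas (j + 2) + 12 * fib (j + 1)
convFib[3,j]-formula j rewrite +-comm j 1 | +-comm j 2 | +-comm j 3 = begin
  50 * convFib 3 j
    ≡⟨ *-assoc 2 25 (convFib 3 j) ⟩
  2 * (25 * convFib 3 j)
    ≡⟨ cong (2 *_) (5^p*convFib[1+p]≡closedForm 2 j) ⟩
  2 * (6 * ((j C j) * F₁) + (3 * ((suc j C j) * L₂) + 1 * (c * (5 * F₃))))
    ≡⟨ cong₂ (λ a b → 2 * (6 * (a * F₁) + (3 * (b * L₂) + 1 * (c * (5 * F₃))))) (nCn≡1 j) ([1+n]Cn≡1+n j) ⟩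
  2 * (6 * (1 * F₁) + (3 * (suc j * L₂) + 1 * (c * (5 * F₃))))
    ≡⟨ identity F₁ L₂ F₃ c (suc j) ⟩
  5 * (2 * c) * F₃ + 6 * suc j * L₂ + 12 * F₁
    ≡⟨ cong (λ z → 5 * z * F₃ + 6 * suc j * L₂ + 12 * F₁) 2*c≡[1+j]*[2+j] ⟩
  5 * (suc j * suc (suc j)) * F₃ + 6 * suc j * L₂ + 12 * F₁
    ≡⟨ cong (λ z → z * F₃ + 6 * suc j * L₂ + 12 * F₁) (*-assoc 5 (suc j) (suc (suc j))) ⟨
  5 * suc j * suc (suc j) * F₃ + 6 * suc j * L₂ + 12 * F₁ ∎
  where
  open ≡-Reasoning
  F₁ L₂ F₃ c : ℕ
  F₁ = fib (suc j)
  L₂ = lucas (suc (suc j))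
  F₃ = fib (suc (suc (suc j)))
  c = (2 + j) C j
  2*c≡[1+j]*[2+j] : 2 * c ≡ suc j * suc (suc j)
  2*c≡[1+j]*[2+j] = trans ([a+1]*[a+1+k]Ck≡[a+1+k]*[a+k]Ck 1 j)
                          (trans (cong (suc (suc j) *_) ([1+n]Cn≡1+n j)) (*-comm (suc (suc j)) (suc j)))
  identity : ∀ F₁ L₂ F₃ c s → 2 * (6 * (1 * F₁) + (3 * (s * L₂) + 1 * (c * (5 * F₃))))
                              ≡ 5 * (2 * c) * F₃ + 6 * s * L₂ + 12 * F₁
  identity = solve-∀

theorem4 : (j r : ℕ) → r ≥ 1 →
    ((+ convFib r j) / 1 ≡ rhs r j)
    × (5 * convFib 2 j ≡ (j + 1) * lucas (j + 2) + 2 * fib (j + 1))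
    × (50 * convFib 3 j ≡ 5 * (j + 1) * (j + 2) * fib (j + 3) + 6 * (j + 1) * lucas (j + 2) + 12 * fib (j + 1))
theorem4 j (suc p) _ = convFib≡rhs p j , convFib[2,j]-formula j , convFib[3,j]-formula j
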